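{- Let $\Gamma_1=\mathrm{Cay}(\mathbb{Z}_3,\{2,1\})$, which is tight and has minimum distance diagram $\mathcal{H}_1=\mathrm{L}(2,2,1,1)$. Then for all integers $t\geq2$: (a) $\mathcal{H}_t=t\mathcal{H}_1=\mathrm{L}(2t,2t,t,t)$ is a tight minimum distance diagram of area $N_t=3t^2$; (b) $\mathcal{H}_t$ is a minimum distance diagram of $\Gamma_t=\mathrm{Cay}(\mathbb{Z}_t\oplus\mathbb{Z}_{3t},\{(1,-1),(0,1)\})$; (c) $\mathrm{D}(\Gamma_t)=\mathrm{D}_2(N_t)=\mathrm{lb}(N_t)=3t-2$.
   Context: A $2$--Cayley digraph is $\mathrm{Cay}(\mathrm{G},\{a,b\})$ with $\mathrm{G}$ a finite Abelian group and $a,b\in\mathrm{G}\setminus\{0\}$ generating it; vertices $\mathrm{G}$, arcs $g\to g+a$, $g\to g+b$; $\mathrm{D}(\cdot)$ denotes its diameter. For $N$ not square-free, $\mathrm{D}_2(N)$ is the minimum of $\mathrm{D}(\mathrm{G},A)$ over all non-cyclic Abelian groups $\mathrm{G}$ of order $N$ and generating sets $A\subset\mathrm{G}\setminus\{0\}$ of size two. $\mathrm{lb}(N)=\lceil\sqrt{3N}\rceil-2$; a $2$--Cayley digraph of order $N$ is tight if its diameter equals $\mathrm{lb}(N)$. A minimum distance diagram of $\mathrm{Cay}(\mathrm{G},\{a,b\})$ is a map $\psi:\mathrm{G}\to\mathbb{N}^2$ with $\psi(\eta)=(i,j)$, $ia+jb=\eta$, $i+j$ minimal, whose image is closed under coordinatewise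 smaller vectors in $\mathbb{N}^2$. For integers $0\le w<l$, $0\le y<h$, the L-shape $\mathrm{L}(l,h,w,y)=\{(i,j)\in\mathbb{Z}^2:0\le i<l,0\le j<h\}\setminus\{(i,j):l-w\le i<l,h-y\le j<h\}$ has area $lh-wy$ and diameter $l+h-\min\{w,y\}-2$; it is a minimum distance diagram of the digraph if it is the image of such a $\psi$, and it is tight if its diameter equals $\mathrm{lb}$ of its area. For an L-shape $\mathcal{H}=\mathrm{L}(l,h,w,y)$, $t\mathcal{H}=\mathrm{L}(tl,th,tw,ty)$. -}

module Defs where

open import Level using (0ℓ)
open import Data.Nat as ℕ using (ℕ; zero; suc; _≤?_; _⊓_; _∸_)
open import Data.Integer as ℤ using (ℤ; +_; -[1+_]; -_)
open import Data.Fin using (Fin)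
open import Data.Product using (Σ; Σ-syntax; _×_; _,_; proj₁; proj₂)
open import Relation.Nullary using (¬_; yes; no)
open import Relation.Binary.PropositionalEquality
  using (_≡_; refl; sym; trans; cong; cong₂)
open import Algebra.Bundles using (AbelianGroup)
open import Algebra.Structures using (IsAbelianGroup)
import Data.Integer.Properties as ℤP
open import Data.Integer.Solver using (module +-*-Solver)

ceilSqrtFrom : ℕ → ℕ → ℕ → ℕ
ceilSqrtFrom zero    r n = r
ceilSqrtFrom (suc f) r n with n ≤? r ℕ.* r
... | yes _ = r
... | no  _ = ceilSqrtFrom f (suc r) n

-- ⌈√n⌉ : the least r with n ≤ r * r  (this r is ≤ n, so fuel n suffices)
ceilSqrt : ℕ → ℕ
ceilSqrt n = ceilSqrtFrom n 0 n

lb : ℕ → ℕ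
lb N = ceilSqrt (3 ℕ.* N) ∸ 2

-- L-shapes  L(l,h,w,y)  (intended with 0 ≤ w < l, 0 ≤ y < h)

record LShape : Set where
  constructor L
  field
    l h w y : ℕ

open LShape public

_∈L_ : ℕ × ℕ → LShape → Set
(i , j) ∈L H =
  (i ℕ.< l H) × (j ℕ.< h H) × ¬ ((l H ∸ w H ℕ.≤ i) × (h H ∸ y H ℕ.≤ j))

areaL : LShape → ℕ
areaL H = l H ℕ.* h H ∸ w H ℕ.* y H

diamL : LShape → ℕ
diamL H = l H ℕ.+ h H ∸ (w H ⊓ y H) ∸ 2

TightL : LShape → Set
TightL H = diamL H ≡ lb (areaL H)

scaleL : ℕ → LShape → LShape
scaleL t H = L (t ℕ.* l H) (t ℕ.* h H) (t ℕ.* w H) (t ℕ.* y H)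

module _ (G : AbelianGroup 0ℓ 0ℓ) where
  open AbelianGroup G

  nmul : ℕ → Carrier → Carrier
  nmul zero    g = ε
  nmul (suc n) g = g ∙ nmul n g

  zmul : ℤ → Carrier → Carrier
  zmul (+ n)      g = nmul n g
  zmul -[1+ n ]   g = (nmul (suc n) g) ⁻¹

  HasOrder : ℕ → Set
  HasOrder N = Σ[ e ∈ (Fin N → Carrier) ]
      ((∀ i j → e i ≈ e j → i ≡ j) × (∀ x → Σ[ i ∈ Fin N ] e i ≈ x))

  IsCyclic : Set
  IsCyclic = Σ[ g ∈ Carrier ] (∀ x → Σ[ z ∈ ℤ ] x ≈ zmul z g)

  Is2Gen : Carrier → Carrier → Set
  Is2Gen a b = ¬ (a ≈ ε) × ¬ (b ≈ ε) × ¬ (a ≈ b) ×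
    (∀ x → Σ[ i ∈ ℤ ] Σ[ j ∈ ℤ ] x ≈ (zmul i a ∙ zmul j b))

  -- The 2-Cayley digraph Cay(G,{a,b}): arcs g → g + a, g → g + b.
  module _ (a b : Carrier) where

    data Walk : Carrier → Carrier → ℕ → Set where
      here  : ∀ {u v} → u ≈ v → Walk u v 0
      stepA : ∀ {u v n} → Walk (u ∙ a) v n → Walk u v (suc n)
      stepB : ∀ {u v n} → Walk (u ∙ b) v n → Walk u v (suc n)

    IsDiameter : ℕ → Set
    IsDiameter d =
      (∀ u v → Σ[ n ∈ ℕ ] (n ℕ.≤ d × Walk u v n)) ×
      (Σ[ u ∈ Carrier ] Σ[ v ∈ Carrier ] (∀ n → Walk u v n → d ℕ.≤ n))

    rep : ℕ × ℕ → Carrier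
    rep (i , j) = nmul i a ∙ nmul j b

    IsMDD : (ℕ × ℕ → Set) → Set
    IsMDD S = Σ[ ψ ∈ (Carrier → ℕ × ℕ) ]
      ((∀ η η′ → η ≈ η′ → ψ η ≡ ψ η′) ×
       (∀ η → rep (ψ η) ≈ η) ×
       (∀ η i j → rep (i , j) ≈ η →
            proj₁ (ψ η) ℕ.+ proj₂ (ψ η) ℕ.≤ i ℕ.+ j) ×
       (∀ p → S p → Σ[ η ∈ Carrier ] ψ η ≡ p) ×
       (∀ η → S (ψ η)) ×
       (∀ η i j → i ℕ.≤ proj₁ (ψ η) → j ℕ.≤ proj₂ (ψ η) →
            Σ[ η′ ∈ Carrier ] ψ η′ ≡ (i , j)))

Admissible : ℕ → (G : AbelianGroup 0ℓ 0ℓ) →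
  AbelianGroup.Carrier G → AbelianGroup.Carrier G → Set
Admissible N G a b = HasOrder G N × ¬ IsCyclic G × Is2Gen G a b

IsD2 : ℕ → ℕ → Set₁
IsD2 N d =
  (Σ[ G ∈ AbelianGroup 0ℓ 0ℓ ] Σ[ a ∈ AbelianGroup.Carrier G ]
     Σ[ b ∈ AbelianGroup.Carrier G ] (Admissible N G a b × IsDiameter G a b d)) ×
  (∀ (G : AbelianGroup 0ℓ 0ℓ) (a b : AbelianGroup.Carrier G) →
     Admissible N G a b → ∀ d′ → IsDiameter G a b d′ → d ℕ.≤ d′)

ModEq : ℕ → ℤ → ℤ → Set
ModEq n x y = Σ[ k ∈ ℤ ] (x ℤ.- y ≡ k ℤ.* + n)

open +-*-Solver

private
  module M (n : ℕ) where
    mrefl : ∀ {x} → ModEq n x x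
    mrefl {x} = + 0 , trans (ℤP.+-inverseʳ x) (sym (ℤP.*-zeroˡ (+ n)))

    msym : ∀ {x y} → ModEq n x y → ModEq n y x
    msym {x} {y} (k , e) = - k , (begin
        y ℤ.- x            ≡⟨ solve 2 (λ x y → y :- x := :- (x :- y)) refl x y ⟩
        - (x ℤ.- y)        ≡⟨ cong -_ e ⟩
        - (k ℤ.* + n)      ≡⟨ ℤP.neg-distribˡ-* k (+ n) ⟩
        - k ℤ.* + n        ∎)
      where open Relation.Binary.PropositionalEquality.≡-Reasoning

    mtrans : ∀ {x y z} → ModEq n x y → ModEq n y z → ModEq n x z
    mtrans {x} {y} {z} (k , e) (k′ , e′) = k ℤ.+ k′ , (begin
        x ℤ.- z                  ≡⟨ solve 3 (λ x y z → x :- z := (x :- y) :+ (y :- z)) refl x y z ⟩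
        (x ℤ.- y) ℤ.+ (y ℤ.- z)  ≡⟨ cong₂ ℤ._+_ e e′ ⟩
        k ℤ.* + n ℤ.+ k′ ℤ.* + n ≡⟨ sym (ℤP.*-distribʳ-+ (+ n) k k′) ⟩
        (k ℤ.+ k′) ℤ.* + n       ∎)
      where open Relation.Binary.PropositionalEquality.≡-Reasoning

    m+ : ∀ {x y u v} → ModEq n x y → ModEq n u v → ModEq n (x ℤ.+ u) (y ℤ.+ v)
    m+ {x} {y} {u} {v} (k , e) (k′ , e′) = k ℤ.+ k′ , (begin
        (x ℤ.+ u) ℤ.- (y ℤ.+ v)  ≡⟨ solve 4 (λ x y u v → (x :+ u) :- (y :+ v) := (x :- y) :+ (u :- v)) refl x y u v ⟩
        (x ℤ.- y) ℤ.+ (u ℤ.- v)  ≡⟨ cong₂ ℤ._+_ e e′ ⟩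
        k ℤ.* + n ℤ.+ k′ ℤ.* + n ≡⟨ sym (ℤP.*-distribʳ-+ (+ n) k k′) ⟩
        (k ℤ.+ k′) ℤ.* + n       ∎)
      where open Relation.Binary.PropositionalEquality.≡-Reasoning

    mneg : ∀ {x y} → ModEq n x y → ModEq n (- x) (- y)
    mneg {x} {y} (k , e) = - k , (begin
        - x ℤ.- - y        ≡⟨ solve 2 (λ x y → :- x :- :- y := :- (x :- y)) refl x y ⟩
        - (x ℤ.- y)        ≡⟨ cong -_ e ⟩
        - (k ℤ.* + n)      ≡⟨ ℤP.neg-distribˡ-* k (+ n) ⟩
        - k ℤ.* + n        ∎)
      where open Relation.Binary.PropositionalEquality.≡-Reasoning

    mfrom≡ : ∀ {x y} → x ≡ y → ModEq n x y
    mfrom≡ {x} refl = mrefl {x}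

ZmZn : ℕ → ℕ → AbelianGroup 0ℓ 0ℓ
ZmZn m n = record
  { Carrier = ℤ × ℤ
  ; _≈_ = λ p q → ModEq m (proj₁ p) (proj₁ q) × ModEq n (proj₂ p) (proj₂ q)
  ; _∙_ = λ p q → (proj₁ p ℤ.+ proj₁ q , proj₂ p ℤ.+ proj₂ q)
  ; ε = (+ 0 , + 0)
  ; _⁻¹ = λ p → (- proj₁ p , - proj₂ p)
  ; isAbelianGroup = record
    { isGroup = record
      { isMonoid = record
        { isSemigroup = record
          { isMagma = record
            { isEquivalence = record
              { refl = λ {p} → M.mrefl m {proj₁ p} , M.mrefl n {proj₂ p}
              ; sym = λ {p} {q} (e , e′) → M.msym m {proj₁ p} {proj₁ q} e , M.msym n {proj₂ p} {proj₂ q} e′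
              ; trans = λ {p} {q} {r} (e , e′) (f , f′) →
                  M.mtrans m {proj₁ p} {proj₁ q} {proj₁ r} e f
                , M.mtrans n {proj₂ p} {proj₂ q} {proj₂ r} e′ f′
              }
            ; ∙-cong = λ {p} {q} {u} {v} (e , e′) (f , f′) →
                M.m+ m {proj₁ p} {proj₁ q} {proj₁ u} {proj₁ v} e f
              , M.m+ n {proj₂ p} {proj₂ q} {proj₂ u} {proj₂ v} e′ f′
            }
          ; assoc = λ p q r → M.mfrom≡ m (ℤP.+-assoc (proj₁ p) (proj₁ q) (proj₁ r))
                            , M.mfrom≡ n (ℤP.+-assoc (proj₂ p) (proj₂ q) (proj₂ r))
          }
        ; identity = (λ p → M.mfrom≡ m (ℤP.+-identityˡ (proj₁ p))
                          , M.mfrom≡ n (ℤP.+-identityˡ (proj₂ p)))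
                   , (λ p → M.mfrom≡ m (ℤP.+-identityʳ (proj₁ p))
                          , M.mfrom≡ n (ℤP.+-identityʳ (proj₂ p)))
        }
      ; inverse = (λ p → M.mfrom≡ m (ℤP.+-inverseˡ (proj₁ p))
                       , M.mfrom≡ n (ℤP.+-inverseˡ (proj₂ p)))
                , (λ p → M.mfrom≡ m (ℤP.+-inverseʳ (proj₁ p))
                       , M.mfrom≡ n (ℤP.+-inverseʳ (proj₂ p)))
      ; ⁻¹-cong = λ {p} {q} (e , e′) → M.mneg m {proj₁ p} {proj₁ q} e , M.mneg n {proj₂ p} {proj₂ q} e′
      }
    ; comm = λ p q → M.mfrom≡ m (ℤP.+-comm (proj₁ p) (proj₁ q))
                   , M.mfrom≡ n (ℤP.+-comm (proj₂ p) (proj₂ q))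
    }
  }

Gt : ℕ → AbelianGroup 0ℓ 0ℓ
Gt t = ZmZn t (3 ℕ.* t)

at : ℤ × ℤ
at = (+ 1 , - (+ 1))

bt : ℤ × ℤ
bt = (+ 0 , + 1)

H₁ : LShape
H₁ = L 2 2 1 1

Ht : ℕ → LShape
Ht t = scaleL t H₁

module Submission where

-- Choose for every element of G its representative i·a + j·b of least weight i + j, ties
-- broken by the smaller j.  The canonical points form a down-closed set.  If (l, 0) and (0, h)
-- are the first non-canonical points on the axes and (0, y), (w, 0) are their canonical
-- representatives, the relations (l, 0) ~ (0, y) and (0, h) ~ (w, 0) force the canonical set
-- into the L-shape L(l, h, w, y) while making all of this L-shape canonical.  Hence
-- N ≤ A(B + y) + wB with A = l - w, B = h - y, whereas its outer corners give
-- D + 2 ≥ A + B + max(w, y); the inequality 3(ab + ac + bc) ≤ (a + b + c)² then yields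
-- 3N ≤ (D + 2)², i.e. D ≥ lb(N) for every 2-Cayley digraph of order N.
-- In Γ_t the relations hold with A = w = B = y = t, so the canonical set lies in L(2t, 2t, t, t);
-- both have 3t² elements, so they coincide, and the diameter 3t - 2 = lb(3t²) is optimal.

open import Defs
open import Level using (0ℓ)
open import Data.Nat using (ℕ; _≤_; _*_; _∸_)
open import Data.Product using (Σ; Σ-syntax; _×_)
open import Relation.Binary.PropositionalEquality using (_≡_)
open import Algebra.Bundles using (AbelianGroup)

open import Data.Nat
  using (zero; suc; _+_; _<_; z≤n; s≤s; z<s; s≤s⁻¹; _≤?_; _<?_; _⊔_; NonZero)
open import Data.Nat.Properties
open import Data.Nat.Induction using (<-wellFounded)
open import Data.Nat.Tactic.RingSolver using (solve-∀)
open import Data.Product using (∃; _,_; proj₁; proj₂)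
open import Data.Product.Properties using (≡-dec)
open import Data.Sum using (_⊎_; inj₁; inj₂; [_,_]′)
open import Data.Empty using (⊥-elim)
open import Relation.Nullary using (¬_; Dec; yes; no; ¬?; _×-dec_)
open import Relation.Nullary.Decidable using (decidable-stable; map′)
open import Relation.Unary using (Decidable)
open import Induction.WellFounded using (Acc; acc)
open import Algebra.Properties.CommutativeSemigroup +-commutativeSemigroup
  using () renaming (interchange to +-interchange)
open import Data.Fin using (Fin; zero; suc; toℕ; fromℕ<; combine; remQuot)
import Data.Fin.Properties as Fin
open import Data.List using (List; []; _∷_; _++_; map; length; lookup; upTo; cartesianProduct)
open import Data.List.Properties using (length-++; length-map; length-upTo)
open import Data.List.Membership.Propositional using (_∈_)
open import Data.List.Membership.Propositional.Properties
  using (∈-map⁺; ∈-++⁺ˡ; ∈-++⁺ʳ; ∈-upTo⁺; ∈-cartesianProduct⁺)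
open import Data.List.Relation.Unary.Any using (index)
open import Data.List.Relation.Unary.Any.Properties using (lookup-index)
open import Data.Integer as ℤ using (ℤ)
import Data.Integer.Properties as ℤₚ
open import Data.Integer.DivMod using (_%ℕ_; _/ℕ_; n%ℕd<d; a≡a%ℕn+[a/ℕn]*n)
import Data.Integer.Tactic.RingSolver as ℤ-Solver
open import Function using (_∘_)
open import Relation.Binary.PropositionalEquality as ≡
  using (_≢_; refl; cong; cong₂; subst; subst₂)

infixl 6 _⊕_
infix 4 _⊑_ _⊏_

Point : Set
Point = ℕ × ℕ

_⊕_ : Point → Point → Point
(i , j) ⊕ (i′ , j′) = (i + i′ , j + j′)

weight : Point → ℕ
weight (i , j) = i + j

-- A total order, so each element of the group has a unique ⊑-least representative.
data _⊑_ (p q : Point) : Set where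
  lighter : weight p < weight q → p ⊑ q
  level   : weight p ≡ weight q → proj₂ p ≤ proj₂ q → p ⊑ q

record _⊏_ (p q : Point) : Set where
  constructor strict
  field
    ⊏⇒⊑ : p ⊑ q
    ⊏⇒≢ : p ≢ q

_≟ₚ_ : (p q : Point) → Dec (p ≡ q)
_≟ₚ_ = ≡-dec _≟_ _≟_

weight-⊕ : ∀ p q → weight (p ⊕ q) ≡ weight p + weight q
weight-⊕ (i , j) (i′ , j′) = +-interchange i i′ j j′

⊑-antisym : ∀ {p q} → p ⊑ q → q ⊑ p → p ≡ q
⊑-antisym (lighter p<q) (lighter q<p) = ⊥-elim (<-asym p<q q<p)
⊑-antisym (lighter p<q) (level q≡p _) = ⊥-elim (<-irrefl (≡.sym q≡p) p<q)
⊑-antisym (level p≡q _) (lighter q<p) = ⊥-elim (<-irrefl (≡.sym p≡q) q<p)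
⊑-antisym {i , j} {i′ , j′} (level p≡q j≤j′) (level _ j′≤j) with ≤-antisym j≤j′ j′≤j
... | refl = cong (_, j) (+-cancelʳ-≡ j i i′ p≡q)

⊕-cancelʳ-⊑ : ∀ {p q} r → p ⊕ r ⊑ q ⊕ r → p ⊑ q
⊕-cancelʳ-⊑ {p} {q} r (lighter pr<qr) =
  lighter (+-cancelʳ-< (weight r) _ _ (subst₂ _<_ (weight-⊕ p r) (weight-⊕ q r) pr<qr))
⊕-cancelʳ-⊑ {p} {q} r (level pr≡qr j≤j′) =
  level (+-cancelʳ-≡ (weight r) _ _ (subst₂ _≡_ (weight-⊕ p r) (weight-⊕ q r) pr≡qr))
        (+-cancelʳ-≤ (proj₂ r) _ _ j≤j′)

weight<⇒⊏ : ∀ {p q} → weight p < weight q → p ⊏ q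
weight<⇒⊏ p<q = strict (lighter p<q) λ { refl → <-irrefl refl p<q }

⊑⇒weight≤ : ∀ {p q} → p ⊑ q → weight p ≤ weight q
⊑⇒weight≤ (lighter p<q) = <⇒≤ p<q
⊑⇒weight≤ (level p≡q _) = ≤-reflexive p≡q

module _ {P : ℕ → Set} (P? : Decidable P) where

  least-witness-from : ∀ {n} → Acc _<_ n → P n → ∃ λ m → P m × (∀ {k} → k < m → ¬ P k)
  least-witness-from {n} (acc smaller) pn with anyUpTo? P? n
  ... | yes (m , m<n , pm) = least-witness-from (smaller m<n) pm
  ... | no none = n , pn , λ k<n pk → none (_ , k<n , pk)

  opaque
    least-witness : ∀ {n} → P n → ∃ λ m → P m × (∀ {k} → k < m → ¬ P k)
    least-witness = least-witness-from (<-wellFounded _)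

length-cartesianProduct : ∀ {A B : Set} (xs : List A) (ys : List B) →
  length (cartesianProduct xs ys) ≡ length xs * length ys
length-cartesianProduct [] ys = refl
length-cartesianProduct (x ∷ xs) ys = begin
  length (map (x ,_) ys ++ cartesianProduct xs ys)
    ≡⟨ length-++ (map (x ,_) ys) ⟩
  length (map (x ,_) ys) + length (cartesianProduct xs ys)
    ≡⟨ cong₂ _+_ (length-map (x ,_) ys) (length-cartesianProduct xs ys) ⟩
  length ys + length xs * length ys ∎
  where open ≡.≡-Reasoning

distinct-members≤length : ∀ {A : Set} {N} (g : Fin N → A) → (∀ {i j} → g i ≡ g j → i ≡ j) →
  (xs : List A) → (∀ i → g i ∈ xs) → N ≤ length xs
distinct-members≤length g g-injective xs g∈xs = Fin.injective⇒≤ position-injective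
  where
  position-injective : ∀ {i j} → index (g∈xs i) ≡ index (g∈xs j) → i ≡ j
  position-injective {i} {j} eq = g-injective (begin
    g i                          ≡⟨ lookup-index (g∈xs i) ⟩
    lookup xs (index (g∈xs i))   ≡⟨ cong (lookup xs) eq ⟩
    lookup xs (index (g∈xs j))   ≡⟨ lookup-index (g∈xs j) ⟨
    g j                          ∎)
    where open ≡.≡-Reasoning

<⇒≡suc+ : ∀ {m n} → m < n → ∃ λ k → n ≡ suc k + m
<⇒≡suc+ {m} m<n with m≤n⇒∃[o]m+o≡n m<n
... | k , refl = k , cong suc (+-comm m k)

2mn≤m²+n² : ∀ m n → 2 * (m * n) ≤ m * m + n * n
2mn≤m²+n² m n = [ ordered , (λ n≤m → subst₂ _≤_ (cong (2 *_) (*-comm n m)) (+-comm (n * n) (m * m))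
                                                (ordered n≤m)) ]′ (≤-total m n)
  where
  ordered : ∀ {m n} → m ≤ n → 2 * (m * n) ≤ m * m + n * n
  ordered {m} m≤n with m≤n⇒∃[o]m+o≡n m≤n
  ... | d , refl = subst (2 * (m * (m + d)) ≤_) (square m d) (m≤m+n _ (d * d))
    where
    square : ∀ m d → 2 * (m * (m + d)) + d * d ≡ m * m + (m + d) * (m + d)
    square = solve-∀

3[ab+ac+bc]≤[a+b+c]² : ∀ a b c → 3 * (a * b + a * c + b * c) ≤ (a + b + c) * (a + b + c)
3[ab+ac+bc]≤[a+b+c]² a b c = subst₂ _≤_ (three a b c) (square a b c) (+-monoʳ-≤ (2 * s) s≤q)
  where
  s = a * b + a * c + b * c
  q = a * a + b * b + c * c
  s≤q : s ≤ q
  s≤q = *-cancelˡ-≤ 2 (subst₂ _≤_ (double a b c) (sum a b c)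
          (+-mono-≤ (+-mono-≤ (2mn≤m²+n² a b) (2mn≤m²+n² a c)) (2mn≤m²+n² b c)))
    where
    double : ∀ a b c → 2 * (a * b) + 2 * (a * c) + 2 * (b * c) ≡ 2 * (a * b + a * c + b * c)
    double = solve-∀
    sum : ∀ a b c → a * a + b * b + (a * a + c * c) + (b * b + c * c) ≡ 2 * (a * a + b * b + c * c)
    sum = solve-∀
  three : ∀ a b c → 2 * (a * b + a * c + b * c) + (a * b + a * c + b * c) ≡ 3 * (a * b + a * c + b * c)
  three = solve-∀
  square : ∀ a b c → 2 * (a * b + a * c + b * c) + (a * a + b * b + c * c) ≡ (a + b + c) * (a + b + c)
  square = solve-∀

lShape-area-bound : ∀ A w B y →
  3 * (A * (B + y) + w * B) ≤ (A + B + (w ⊔ y)) * (A + B + (w ⊔ y))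
lShape-area-bound A w B y = ≤-trans (*-monoʳ-≤ 3 area≤) (3[ab+ac+bc]≤[a+b+c]² A B (w ⊔ y))
  where
  area≤ : A * (B + y) + w * B ≤ A * B + A * (w ⊔ y) + B * (w ⊔ y)
  area≤ = subst₂ _≤_ (rearrange A B y w) (≡.sym (+-assoc (A * B) _ _))
            (+-monoʳ-≤ (A * B) (+-mono-≤ (*-monoʳ-≤ A (m≤n⊔m w y)) (*-monoʳ-≤ B (m≤m⊔n w y))))
    where
    rearrange : ∀ A B y w → A * B + (A * y + B * w) ≡ A * (B + y) + w * B
    rearrange = solve-∀

lShape-size-bound : ∀ A′ w B′ y D → A′ + w + B′ ≤ D → A′ + (B′ + y) ≤ D →
  suc A′ + suc B′ + (w ⊔ y) ≤ D + 2
lShape-size-bound A′ w B′ y D corner₁ corner₂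
  rewrite +-distribˡ-⊔ (suc A′ + suc B′) w y =
  ⊔-lub (subst (_≤ D + 2) (shift₁ A′ w B′) (+-monoˡ-≤ 2 corner₁))
        (subst (_≤ D + 2) (shift₂ A′ B′ y) (+-monoˡ-≤ 2 corner₂))
  where
  shift₁ : ∀ A′ w B′ → A′ + w + B′ + 2 ≡ suc A′ + suc B′ + w
  shift₁ = solve-∀
  shift₂ : ∀ A′ B′ y → A′ + (B′ + y) + 2 ≡ suc A′ + suc B′ + y
  shift₂ = solve-∀

m*m≤n*n⇒m≤n : ∀ {m n} → m * m ≤ n * n → m ≤ n
m*m≤n*n⇒m≤n m²≤n² = ≮⇒≥ λ n<m → <⇒≱ (*-mono-< n<m n<m) m²≤n²

-- L-shapes

-- L(A + w, B + y, w, y) with its notch at (A, B), stated without truncated subtraction.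
InL : ℕ → ℕ → ℕ → ℕ → Point → Set
InL A w B y (i , j) = i < A + w × j < B + y × ¬ (A ≤ i × B ≤ j)

InL-mono : ∀ {A w B y e f i j} → e ≤ i → f ≤ j → InL A w B y (i , j) → InL A w B y (e , f)
InL-mono e≤i f≤j (i<A+w , j<B+y , outside) =
  ≤-<-trans e≤i i<A+w , ≤-<-trans f≤j j<B+y ,
  λ (A≤e , B≤f) → outside (≤-trans A≤e e≤i , ≤-trans B≤f f≤j)

lShape : ℕ → ℕ → ℕ → ℕ → List Point
lShape A w B y =
  cartesianProduct (upTo A) (upTo (B + y)) ++ cartesianProduct (map (A +_) (upTo w)) (upTo B)

length-lShape : ∀ A w B y → length (lShape A w B y) ≡ A * (B + y) + w * B
length-lShape A w B y
  rewrite length-++ (cartesianProduct (upTo A) (upTo (B + y)))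
                    {cartesianProduct (map (A +_) (upTo w)) (upTo B)}
        | length-cartesianProduct (upTo A) (upTo (B + y))
        | length-cartesianProduct (map (A +_) (upTo w)) (upTo B)
        | length-map (A +_) (upTo w)
        | length-upTo A | length-upTo w | length-upTo B | length-upTo (B + y) = refl

∈-lShape : ∀ {A w B y i j} → InL A w B y (i , j) → (i , j) ∈ lShape A w B y
∈-lShape {A} {w} {B} {y} {i} {j} (i<A+w , j<B+y , outside) with A ≤? i
... | no A≰i = ∈-++⁺ˡ (∈-cartesianProduct⁺ (∈-upTo⁺ (≰⇒> A≰i)) (∈-upTo⁺ j<B+y))
... | yes A≤i with m≤n⇒∃[o]m+o≡n A≤i
...   | k , refl = ∈-++⁺ʳ (cartesianProduct (upTo A) (upTo (B + y)))
  (∈-cartesianProduct⁺ (∈-map⁺ (A +_) (∈-upTo⁺ (+-cancelˡ-< A k w i<A+w)))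
                       (∈-upTo⁺ (≰⇒> λ B≤j → outside (A≤i , B≤j))))

∈L⇒InL : ∀ {A w B y p} → p ∈L L (A + w) (B + y) w y → InL A w B y p
∈L⇒InL {A} {w} {B} {y} (i< , j< , outside) = i< , j< , λ (A≤i , B≤j) →
  outside (subst (_≤ _) (≡.sym (m+n∸n≡m A w)) A≤i , subst (_≤ _) (≡.sym (m+n∸n≡m B y)) B≤j)

InL⇒∈L : ∀ {A w B y p} → InL A w B y p → p ∈L L (A + w) (B + y) w y
InL⇒∈L {A} {w} {B} {y} (i< , j< , outside) = i< , j< , λ (A≤i , B≤j) →
  outside (subst (_≤ _) (m+n∸n≡m A w) A≤i , subst (_≤ _) (m+n∸n≡m B y) B≤j)

InL-weight : ∀ {A w B y i j} → InL A w B y (i , j) → i + j + 2 ≤ A + B + (w ⊔ y)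
InL-weight {A} {w} {B} {y} {i} {j} (i<A+w , j<B+y , outside) =
  subst (_≤ A + B + (w ⊔ y)) (shift i j) (by-column (A ≤? i))
  where
  shift : ∀ i j → suc i + suc j ≡ i + j + 2
  shift = solve-∀
  swap : ∀ A B w → A + B + w ≡ A + w + B
  swap = solve-∀
  by-column : Dec (A ≤ i) → suc i + suc j ≤ A + B + (w ⊔ y)
  by-column (yes A≤i) = ≤-trans (+-mono-≤ i<A+w (≰⇒> λ B≤j → outside (A≤i , B≤j)))
    (subst (_≤ A + B + (w ⊔ y)) (swap A B w) (+-monoʳ-≤ (A + B) (m≤m⊔n w y)))
  by-column (no A≰i) = ≤-trans (+-mono-≤ (≰⇒> A≰i) j<B+y)
    (subst (_≤ A + B + (w ⊔ y)) (+-assoc A B y) (+-monoʳ-≤ (A + B) (m≤n⊔m w y)))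

module _ (G : AbelianGroup 0ℓ 0ℓ) where
  open AbelianGroup G
    using (Carrier; _≈_; _∙_; ε; ∙-congˡ; assoc; identityˡ)
    renaming (sym to ≈-sym; trans to ≈-trans)

  nmul-+ : ∀ m n g → nmul G (m + n) g ≈ nmul G m g ∙ nmul G n g
  nmul-+ zero n g = ≈-sym (identityˡ _)
  nmul-+ (suc m) n g = ≈-trans (∙-congˡ (nmul-+ m n g)) (≈-sym (assoc _ _ _))

  HasOrder⇒decidable : ∀ {N} → HasOrder G N → ∀ x y → Dec (x ≈ y)
  HasOrder⇒decidable (e , e-injective , e-surjective) x y
    with e-surjective x | e-surjective y
  ... | i , eᵢ≈x | j , eⱼ≈y with i Fin.≟ j
  ...   | yes refl = yes (≈-trans (≈-sym eᵢ≈x) eⱼ≈y)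
  ...   | no i≢j = no λ x≈y → i≢j (e-injective i j (≈-trans eᵢ≈x (≈-trans x≈y (≈-sym eⱼ≈y))))

  order≤length : ∀ {N} → HasOrder G N → (f : Carrier → Point) →
    (∀ x y → f x ≡ f y → x ≈ y) → (xs : List Point) → (∀ x → f x ∈ xs) → N ≤ length xs
  order≤length (e , e-injective , _) f f-injective xs f∈xs =
    distinct-members≤length (f ∘ e) (λ eq → e-injective _ _ (f-injective _ _ eq)) xs (f∈xs ∘ e)

  order<length : ∀ {N} → HasOrder G N → (f : Carrier → Point) →
    (∀ x y → f x ≡ f y → x ≈ y) → (xs : List Point) → (∀ x → f x ∈ xs) →
    ∀ {p} → p ∈ xs → (∀ x → f x ≢ p) → N < length xs
  order<length {N} (e , e-injective , _) f f-injective xs f∈xs {p} p∈xs f≢p =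
    distinct-members≤length g g-injective xs g∈xs
    where
    g : Fin (suc N) → Point
    g zero = p
    g (suc i) = f (e i)
    g-injective : ∀ {i j} → g i ≡ g j → i ≡ j
    g-injective {zero} {zero} _ = refl
    g-injective {zero} {suc j} eq = ⊥-elim (f≢p (e j) (≡.sym eq))
    g-injective {suc i} {zero} eq = ⊥-elim (f≢p (e i) eq)
    g-injective {suc i} {suc j} eq = cong suc (e-injective i j (f-injective _ _ eq))
    g∈xs : ∀ i → g i ∈ xs
    g∈xs zero = p∈xs
    g∈xs (suc i) = f∈xs (e i)

-- Minimal representatives in a two-generated Abelian group

module Representations (G : AbelianGroup 0ℓ 0ℓ) (a b : AbelianGroup.Carrier G) where
  open AbelianGroup G
    hiding (refl) renaming (sym to ≈-sym; trans to ≈-trans; reflexive to ≈-reflexive)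
  open import Algebra.Properties.Group group using (∙-cancelˡ; ∙-cancelʳ; \\-leftDividesˡ)
  open import Algebra.Properties.CommutativeSemigroup commutativeSemigroup
    using (interchange; x∙yz≈y∙xz)

  ⟦_⟧ : Point → Carrier
  ⟦_⟧ = rep G a b

  ⟦⟧-cong : ∀ {p q} → p ≡ q → ⟦ p ⟧ ≈ ⟦ q ⟧
  ⟦⟧-cong = ≈-reflexive ∘ cong ⟦_⟧

  ⟦⟧-⊕ : ∀ p q → ⟦ p ⊕ q ⟧ ≈ ⟦ p ⟧ ∙ ⟦ q ⟧
  ⟦⟧-⊕ (i , j) (i′ , j′) =
    ≈-trans (∙-cong (nmul-+ G i i′ a) (nmul-+ G j j′ b)) (interchange _ _ _ _)

  ⟦⟧-⊕-congʳ : ∀ p q r → ⟦ p ⟧ ≈ ⟦ q ⟧ → ⟦ p ⊕ r ⟧ ≈ ⟦ q ⊕ r ⟧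
  ⟦⟧-⊕-congʳ p q r p≈q = ≈-trans (⟦⟧-⊕ p r) (≈-trans (∙-congʳ p≈q) (≈-sym (⟦⟧-⊕ q r)))

  ⟦⟧-⊕-cancelʳ : ∀ p q r → ⟦ p ⊕ r ⟧ ≈ ⟦ q ⊕ r ⟧ → ⟦ p ⟧ ≈ ⟦ q ⟧
  ⟦⟧-⊕-cancelʳ p q r pr≈qr =
    ∙-cancelʳ ⟦ r ⟧ ⟦ p ⟧ ⟦ q ⟧ (≈-trans (≈-sym (⟦⟧-⊕ p r)) (≈-trans pr≈qr (⟦⟧-⊕ q r)))

  ⟦⟧-cancel-suc₁ : ∀ {i j i′ j′} → ⟦ suc i , j ⟧ ≈ ⟦ suc i′ , j′ ⟧ → ⟦ i , j ⟧ ≈ ⟦ i′ , j′ ⟧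
  ⟦⟧-cancel-suc₁ eq = ∙-cancelˡ a _ _ (≈-trans (≈-sym (assoc _ _ _)) (≈-trans eq (assoc _ _ _)))

  ⟦⟧-cancel-suc₂ : ∀ {i j i′ j′} → ⟦ i , suc j ⟧ ≈ ⟦ i′ , suc j′ ⟧ → ⟦ i , j ⟧ ≈ ⟦ i′ , j′ ⟧
  ⟦⟧-cancel-suc₂ eq =
    ∙-cancelˡ b _ _ (≈-trans (≈-sym (x∙yz≈y∙xz _ _ _)) (≈-trans eq (x∙yz≈y∙xz _ _ _)))

  walk⇒rep : ∀ {u v n} → Walk G a b u v n → ∃ λ p → weight p ≡ n × u ∙ ⟦ p ⟧ ≈ v
  walk⇒rep {u} (here u≈v) = (0 , 0) , refl , ≈-trans (∙-congˡ (identityˡ ε)) (≈-trans (identityʳ u) u≈v)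
  walk⇒rep {u} (stepA walk) with walk⇒rep walk
  ... | (i , j) , refl , ends =
    (suc i , j) , refl , ≈-trans (∙-congˡ (assoc a _ _)) (≈-trans (≈-sym (assoc u a _)) ends)
  walk⇒rep {u} (stepB walk) with walk⇒rep walk
  ... | (i , j) , refl , ends = (i , suc j) , +-suc i j ,
    ≈-trans (∙-congˡ (x∙yz≈y∙xz (nmul G i a) b (nmul G j b))) (≈-trans (≈-sym (assoc u b _)) ends)

  rep⇒walk : ∀ u v p → u ∙ ⟦ p ⟧ ≈ v → Walk G a b u v (weight p)
  rep⇒walk u v (zero , zero) ends =
    here (≈-trans (≈-sym (≈-trans (∙-congˡ (identityˡ ε)) (identityʳ u))) ends)
  rep⇒walk u v (suc i , j) ends =
    stepA (rep⇒walk (u ∙ a) v (i , j) (≈-trans (assoc u a _) (≈-trans (∙-congˡ (≈-sym (assoc a _ _))) ends)))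
  rep⇒walk u v (zero , suc j) ends =
    stepB (rep⇒walk (u ∙ b) v (zero , j)
      (≈-trans (assoc u b _) (≈-trans (∙-congˡ (≈-sym (x∙yz≈y∙xz ε b (nmul G j b)))) ends)))

  record Minimal (p : Point) : Set where
    constructor minimal
    field least : ∀ q → ⟦ q ⟧ ≈ ⟦ p ⟧ → p ⊑ q
  open Minimal

  minimal-origin : Minimal (0 , 0)
  least minimal-origin (zero , zero) _ = level refl z≤n
  least minimal-origin (zero , suc j) _ = lighter z<s
  least minimal-origin (suc i , j) _ = lighter z<s

  minimal-unique : ∀ {p q} → Minimal p → Minimal q → ⟦ p ⟧ ≈ ⟦ q ⟧ → p ≡ q
  minimal-unique {p} {q} p-min q-min p≈q = ⊑-antisym (least p-min q (≈-sym p≈q)) (least q-min p p≈q)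

  ¬minimal : ∀ {p q} → ⟦ q ⟧ ≈ ⟦ p ⟧ → q ⊏ p → ¬ Minimal p
  ¬minimal q≈p (strict q⊑p q≢p) p-min = q≢p (⊑-antisym q⊑p (least p-min _ q≈p))

  minimal-mono : ∀ {i′ i j′ j} → i′ ≤ i → j′ ≤ j → Minimal (i , j) → Minimal (i′ , j′)
  minimal-mono {i′} {_} {j′} i′≤i j′≤j m with m≤n⇒∃[o]m+o≡n i′≤i | m≤n⇒∃[o]m+o≡n j′≤j
  ... | k , refl | l , refl = minimal λ q q≈ →
    ⊕-cancelʳ-⊑ (k , l) (least m (q ⊕ (k , l)) (⟦⟧-⊕-congʳ q (i′ , j′) (k , l) q≈))

  walk-length≥ : ∀ {c} → Minimal c → ∀ {n} → Walk G a b ε ⟦ c ⟧ n → weight c ≤ n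
  walk-length≥ {c} c-min walk with walk⇒rep walk
  ... | p , refl , p≈c = ⊑⇒weight≤ (least c-min p (≈-trans (≈-sym (identityˡ ⟦ p ⟧)) p≈c))

  walk-from-difference : ∀ u v p → ⟦ p ⟧ ≈ u ⁻¹ ∙ v → Walk G a b u v (weight p)
  walk-from-difference u v p p≈ = rep⇒walk u v p (≈-trans (∙-congˡ p≈) (\\-leftDividesˡ u v))

  module Canonical (_≈?_ : ∀ x y → Dec (x ≈ y)) (reachable : ∀ η → ∃ λ p → ⟦ p ⟧ ≈ η) where

    OnAntidiagonal : Carrier → ℕ → ℕ → Set
    OnAntidiagonal η s j = j < suc s × ⟦ s ∸ j , j ⟧ ≈ η

    HasWeight : Carrier → ℕ → Set
    HasWeight η s = ∃ (OnAntidiagonal η s)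

    on-antidiagonal : ∀ {η} i j → ⟦ i , j ⟧ ≈ η → OnAntidiagonal η (i + j) j
    on-antidiagonal i j ij≈η =
      s≤s (m≤n+m j i) , ≈-trans (⟦⟧-cong (cong (_, j) (m+n∸n≡m i j))) ij≈η

    opaque
      least-weight : ∀ η → ∃ λ s → HasWeight η s × ∀ {k} → k < s → ¬ HasWeight η k
      least-weight η with reachable η
      ... | (i , j) , ij≈η =
        least-witness (λ s → anyUpTo? (λ j → ⟦ s ∸ j , j ⟧ ≈? η) (suc s)) (j , on-antidiagonal i j ij≈η)

      least-second : ∀ η → let s = proj₁ (least-weight η) in
        ∃ λ j → OnAntidiagonal η s j × ∀ {k} → k < j → ¬ OnAntidiagonal η s k
      least-second η = least-witness (λ j → (j <? suc s) ×-dec (⟦ s ∸ j , j ⟧ ≈? η))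
                                     (proj₂ (proj₁ (proj₂ (least-weight η))))
        where
        s : ℕ
        s = proj₁ (least-weight η)

      ψ : Carrier → Point
      ψ η = proj₁ (least-weight η) ∸ proj₁ (least-second η) , proj₁ (least-second η)

      ψ-rep : ∀ η → ⟦ ψ η ⟧ ≈ η
      ψ-rep η = proj₂ (proj₁ (proj₂ (least-second η)))

      weight-ψ : ∀ η → weight (ψ η) ≡ proj₁ (least-weight η)
      weight-ψ η = m∸n+n≡m (s≤s⁻¹ (proj₁ (proj₁ (proj₂ (least-second η)))))

      ψ-least : ∀ η i j → ⟦ i , j ⟧ ≈ η → ψ η ⊑ (i , j)
      ψ-least η i j ij≈η = compare (m≤n⇒m<n∨m≡n s≤i+j)
        where
        s : ℕ
        s = proj₁ (least-weight η)
        s≤i+j : s ≤ i + j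
        s≤i+j = ≮⇒≥ λ i+j<s → proj₂ (proj₂ (least-weight η)) i+j<s (j , on-antidiagonal i j ij≈η)
        compare : s < i + j ⊎ s ≡ i + j → ψ η ⊑ (i , j)
        compare (inj₁ s<i+j) = lighter (subst (_< i + j) (≡.sym (weight-ψ η)) s<i+j)
        compare (inj₂ s≡i+j) = level (≡.trans (weight-ψ η) s≡i+j) (≮⇒≥ λ j<ψ₂ →
          proj₂ (proj₂ (least-second η)) j<ψ₂
            (subst (λ s → OnAntidiagonal η s j) (≡.sym s≡i+j) (on-antidiagonal i j ij≈η)))

    ψ-minimal : ∀ η → Minimal (ψ η)
    ψ-minimal η = minimal λ (i , j) ij≈ψη → ψ-least η i j (≈-trans ij≈ψη (ψ-rep η))

    canonical : ∀ p → ∃ λ q → Minimal q × ⟦ q ⟧ ≈ ⟦ p ⟧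
    canonical p = ψ ⟦ p ⟧ , ψ-minimal ⟦ p ⟧ , ψ-rep ⟦ p ⟧

    minimal⇒ψ : ∀ {p} → Minimal p → ψ ⟦ p ⟧ ≡ p
    minimal⇒ψ {p} p-min = minimal-unique (ψ-minimal ⟦ p ⟧) p-min (ψ-rep ⟦ p ⟧)

    minimal? : ∀ p → Dec (Minimal p)
    minimal? p = map′ (λ ψ≡p → subst Minimal ψ≡p (ψ-minimal ⟦ p ⟧)) minimal⇒ψ (ψ ⟦ p ⟧ ≟ₚ p)

    ψ-cong : ∀ x y → x ≈ y → ψ x ≡ ψ y
    ψ-cong x y x≈y =
      minimal-unique (ψ-minimal x) (ψ-minimal y) (≈-trans (ψ-rep x) (≈-trans x≈y (≈-sym (ψ-rep y))))

    ψ-injective : ∀ x y → ψ x ≡ ψ y → x ≈ y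
    ψ-injective x y ψx≡ψy = ≈-trans (≈-sym (ψ-rep x)) (≈-trans (⟦⟧-cong ψx≡ψy) (ψ-rep y))

    isMDD : (S : Point → Set) → (∀ {p} → S p → Minimal p) → (∀ {p} → Minimal p → S p) →
      IsMDD G a b S
    isMDD S S⇒minimal minimal⇒S =
      ψ , ψ-cong , ψ-rep , weight-least , (λ p Sp → ⟦ p ⟧ , minimal⇒ψ (S⇒minimal Sp)) ,
      (λ η → minimal⇒S (ψ-minimal η)) , down-closed
      where
      weight-least : ∀ η i j → ⟦ i , j ⟧ ≈ η → weight (ψ η) ≤ i + j
      weight-least η i j ij≈η = ⊑⇒weight≤ (ψ-least η i j ij≈η)
      down-closed : ∀ η i j → i ≤ proj₁ (ψ η) → j ≤ proj₂ (ψ η) → ∃ λ η′ → ψ η′ ≡ (i , j)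
      down-closed η i j i≤ j≤ = ⟦ i , j ⟧ , minimal⇒ψ (minimal-mono i≤ j≤ (ψ-minimal η))

    isDiameter : ∀ {D} → (∀ {p} → Minimal p → weight p ≤ D) →
      ∀ {c} → Minimal c → weight c ≡ D → IsDiameter G a b D
    isDiameter bound {c} c-min refl =
      (λ u v → weight (ψ (u ⁻¹ ∙ v)) , bound (ψ-minimal (u ⁻¹ ∙ v)) ,
               walk-from-difference u v (ψ (u ⁻¹ ∙ v)) (ψ-rep (u ⁻¹ ∙ v))) ,
      ε , ⟦ c ⟧ , λ n walk → walk-length≥ c-min walk

    axis₁-return : ∀ {l} → ¬ Minimal (l , 0) → (∀ {i} → i < l → Minimal (i , 0)) →
      ∃ λ y → Minimal (0 , y) × ⟦ l , 0 ⟧ ≈ ⟦ 0 , y ⟧ × (0 , y) ⊏ (l , 0)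
    axis₁-return {zero} ¬minimal-l _ = ⊥-elim (¬minimal-l minimal-origin)
    axis₁-return {suc l} ¬minimal-l below with canonical (suc l , 0)
    ... | (zero , y) , q-min , q≈ =
      y , q-min , ≈-sym q≈ ,
      strict (least q-min (suc l , 0) (≈-sym q≈)) (λ q≡ → ¬minimal-l (subst Minimal q≡ q-min))
    ... | (suc x , y) , q-min , q≈
      with minimal-unique (minimal-mono (n≤1+n x) ≤-refl q-min) (below ≤-refl)
                          (⟦⟧-cancel-suc₁ {x} {y} {l} {0} q≈)
    ...   | refl = ⊥-elim (¬minimal-l q-min)

    axis₂-return : ∀ {h} → ¬ Minimal (0 , h) → (∀ {j} → j < h → Minimal (0 , j)) →
      ∃ λ w → Minimal (w , 0) × ⟦ 0 , h ⟧ ≈ ⟦ w , 0 ⟧ × (w , 0) ⊏ (0 , h)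
    axis₂-return {zero} ¬minimal-h _ = ⊥-elim (¬minimal-h minimal-origin)
    axis₂-return {suc h} ¬minimal-h below with canonical (0 , suc h)
    ... | (w , zero) , q-min , q≈ =
      w , q-min , ≈-sym q≈ ,
      strict (least q-min (0 , suc h) (≈-sym q≈)) (λ q≡ → ¬minimal-h (subst Minimal q≡ q-min))
    ... | (w , suc y) , q-min , q≈
      with minimal-unique (minimal-mono ≤-refl (n≤1+n y) q-min) (below ≤-refl)
                          (⟦⟧-cancel-suc₂ {w} {y} {0} {h} q≈)
    ...   | refl = ⊥-elim (¬minimal-h q-min)

    module LTile (A w B y : ℕ) (1≤A : 1 ≤ A) (1≤B : 1 ≤ B)
      (rel₁ : ⟦ A + w , 0 ⟧ ≈ ⟦ 0 , y ⟧) (rel₂ : ⟦ 0 , B + y ⟧ ≈ ⟦ w , 0 ⟧)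
      (y⊏ : (0 , y) ⊏ (A + w , 0)) (w⊏ : (w , 0) ⊏ (0 , B + y)) where

      corner : ⟦ A , B ⟧ ≈ ⟦ 0 , 0 ⟧
      corner = ⟦⟧-⊕-cancelʳ (A , B) (0 , 0) (w , y) (begin
        ⟦ A + w , B + y ⟧                ≈⟨ ⟦⟧-cong (cong (_, B + y) (+-identityʳ (A + w))) ⟨
        ⟦ (A + w , 0) ⊕ (0 , B + y) ⟧    ≈⟨ ⟦⟧-⊕ (A + w , 0) (0 , B + y) ⟩
        ⟦ A + w , 0 ⟧ ∙ ⟦ 0 , B + y ⟧    ≈⟨ ∙-cong rel₁ rel₂ ⟩
        ⟦ 0 , y ⟧ ∙ ⟦ w , 0 ⟧            ≈⟨ ⟦⟧-⊕ (0 , y) (w , 0) ⟨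
        ⟦ w , y + 0 ⟧                    ≈⟨ ⟦⟧-cong (cong (w ,_) (+-identityʳ y)) ⟩
        ⟦ w , y ⟧                        ∎)
        where open import Relation.Binary.Reasoning.Setoid setoid

      minimal⇒InL : ∀ {p} → Minimal p → InL A w B y p
      minimal⇒InL p-min =
        ≰⇒> (λ A+w≤i → ¬minimal (≈-sym rel₁) y⊏ (minimal-mono A+w≤i z≤n p-min)) ,
        ≰⇒> (λ B+y≤j → ¬minimal (≈-sym rel₂) w⊏ (minimal-mono z≤n B+y≤j p-min)) ,
        λ (A≤i , B≤j) → ¬minimal (≈-sym corner) (weight<⇒⊏ {0 , 0} {A , B} (≤-trans 1≤A (m≤m+n A B)))
                                 (minimal-mono A≤i B≤j p-min)

      module _ (axis₁ : ∀ {i} → i < A + w → Minimal (i , 0))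
               (axis₂ : ∀ {j} → j < B + y → Minimal (0 , j)) where

        axes-coincide : ∀ {x z} → x < A + w → z < B + y → ⟦ x , 0 ⟧ ≈ ⟦ 0 , z ⟧ → x ≡ 0 × z ≡ 0
        axes-coincide x< z< x≈z with minimal-unique (axis₁ x<) (axis₂ z<) x≈z
        ... | refl = refl , refl

        L-period-trivial : ∀ {e f} → InL A w B y (e , f) → ⟦ e , f ⟧ ≈ ⟦ 0 , 0 ⟧ → e ≡ 0 × f ≡ 0
        L-period-trivial {zero} (_ , f< , _) period = axes-coincide (≤-trans 1≤A (m≤m+n A w)) f< (≈-sym period)
        L-period-trivial {suc e} {zero} (e< , _ , _) period = axes-coincide e< (≤-trans 1≤B (m≤m+n B y)) period
        L-period-trivial {suc e} {suc f} (e< , f< , outside) period = ⊥-elim (outside (A≤ , B≤))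
          where
          shift : ∀ r → ⟦ (suc e , suc f) ⊕ r ⟧ ≈ ⟦ r ⟧
          shift r = ⟦⟧-⊕-congʳ (suc e , suc f) (0 , 0) r period
          B≤ : B ≤ suc f
          B≤ = ≮⇒≥ λ f<B → let e′ , e+e′≡ = m≤n⇒∃[o]m+o≡n (<⇒≤ e<) in
            m+1+n≢0 y (proj₂ (axes-coincide
              (subst (e′ <_) e+e′≡ (m<n+m e′ z<s))
              (subst (y + suc f <_) (+-comm y B) (+-monoʳ-< y f<B))
              (≈-trans (≈-sym (shift (e′ , 0)))
                (≈-trans (⟦⟧-cong (cong₂ _,_ (≡.trans e+e′≡ (≡.sym (+-identityʳ (A + w))))
                                             (+-identityʳ (suc f))))
                         (⟦⟧-⊕-congʳ (A + w , 0) (0 , y) (0 , suc f) rel₁)))))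
          A≤ : A ≤ suc e
          A≤ = ≮⇒≥ λ e<A → let f′ , f+f′≡ = m≤n⇒∃[o]m+o≡n (<⇒≤ f<) in
            m+1+n≢0 w (proj₁ (axes-coincide
              (subst (w + suc e <_) (+-comm w A) (+-monoʳ-< w e<A))
              (subst (f′ <_) f+f′≡ (m<n+m f′ z<s))
              (≈-trans (≈-sym (⟦⟧-⊕-congʳ (0 , B + y) (w , 0) (suc e , 0) rel₂))
                (≈-trans (⟦⟧-cong (cong₂ _,_ (≡.sym (+-identityʳ (suc e)))
                                             (≡.trans (+-identityʳ (B + y)) (≡.sym f+f′≡))))
                         (shift (0 , f′))))))

        -- After subtracting the coordinatewise minimum of q and p, what is left is either a
        -- period inside L or a pair of axis points with equal value.
        minimal-rep-in-L : ∀ {q p} → Minimal q → ⟦ q ⟧ ≈ ⟦ p ⟧ → InL A w B y p → q ≡ p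
        minimal-rep-in-L {q₁ , q₂} {p₁ , p₂} q-min q≈p p∈L
          with ≤-<-connex q₁ p₁ | ≤-<-connex q₂ p₂ | minimal⇒InL q-min
        ... | inj₁ q₁≤p₁ | inj₁ q₂≤p₂ | _
          with m≤n⇒∃[o]m+o≡n q₁≤p₁ | m≤n⇒∃[o]m+o≡n q₂≤p₂
        ...   | e , refl | f , refl
          with L-period-trivial (InL-mono (m≤n+m e q₁) (m≤n+m f q₂) p∈L)
                 (⟦⟧-⊕-cancelʳ (e , f) (0 , 0) (q₁ , q₂)
                   (≈-trans (⟦⟧-cong (cong₂ _,_ (+-comm e q₁) (+-comm f q₂))) (≈-sym q≈p)))
        ...     | refl , refl = cong₂ _,_ (≡.sym (+-identityʳ q₁)) (≡.sym (+-identityʳ q₂))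
        minimal-rep-in-L {q₁ , q₂} {p₁ , p₂} q-min q≈p p∈L
          | inj₁ q₁≤p₁ | inj₂ p₂<q₂ | (_ , q₂< , _)
          with m≤n⇒∃[o]m+o≡n q₁≤p₁ | m≤n⇒∃[o]m+o≡n p₂<q₂
        ...   | e , refl | f , refl =
          ⊥-elim (1+n≢0 (proj₂ (axes-coincide (≤-<-trans (m≤n+m e q₁) (proj₁ p∈L))
                                              (≤-<-trans (s≤s (m≤n+m f p₂)) q₂<) e≈1+f)))
          where
          e≈1+f : ⟦ e , 0 ⟧ ≈ ⟦ 0 , suc f ⟧
          e≈1+f = ⟦⟧-⊕-cancelʳ (e , 0) (0 , suc f) (q₁ , p₂)
            (≈-trans (⟦⟧-cong (cong (_, p₂) (+-comm e q₁)))
              (≈-trans (≈-sym q≈p) (⟦⟧-cong (cong (q₁ ,_) (cong suc (+-comm p₂ f))))))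
        minimal-rep-in-L {q₁ , q₂} {p₁ , p₂} q-min q≈p p∈L
          | inj₂ p₁<q₁ | inj₁ q₂≤p₂ | (q₁< , _ , _)
          with m≤n⇒∃[o]m+o≡n p₁<q₁ | m≤n⇒∃[o]m+o≡n q₂≤p₂
        ...   | e , refl | f , refl =
          ⊥-elim (1+n≢0 (proj₁ (axes-coincide (≤-<-trans (s≤s (m≤n+m e p₁)) q₁<)
                                              (≤-<-trans (m≤n+m f q₂) (proj₁ (proj₂ p∈L))) 1+e≈f)))
          where
          1+e≈f : ⟦ suc e , 0 ⟧ ≈ ⟦ 0 , f ⟧
          1+e≈f = ⟦⟧-⊕-cancelʳ (suc e , 0) (0 , f) (p₁ , q₂)
            (≈-trans (⟦⟧-cong (cong (_, q₂) (cong suc (+-comm e p₁))))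
              (≈-trans q≈p (⟦⟧-cong (cong (p₁ ,_) (+-comm q₂ f)))))
        minimal-rep-in-L {q₁ , q₂} {p₁ , p₂} q-min q≈p p∈L
          | inj₂ p₁<q₁ | inj₂ p₂<q₂ | _ =
          ⊥-elim (<⇒≱ (+-mono-< p₁<q₁ p₂<q₂) (⊑⇒weight≤ (least q-min (p₁ , p₂) (≈-sym q≈p))))

        InL⇒minimal : ∀ {p} → InL A w B y p → Minimal p
        InL⇒minimal {p} p∈L with canonical p
        ... | q , q-min , q≈p = subst Minimal (minimal-rep-in-L q-min q≈p p∈L) q-min

  module _ {N D} (order : HasOrder G N) (diameter : ∀ u v → ∃ λ n → n ≤ D × Walk G a b u v n) where

    reachable-within : ∀ η → ∃ λ p → weight p ≤ D × ⟦ p ⟧ ≈ η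
    reachable-within η with diameter ε η
    ... | n , n≤D , walk with walk⇒rep walk
    ...   | p , refl , ends = p , n≤D , ≈-trans (≈-sym (identityˡ ⟦ p ⟧)) ends

    open Canonical (HasOrder⇒decidable G order)
                   (λ η → proj₁ (reachable-within η) , proj₂ (proj₂ (reachable-within η)))

    minimal-weight≤ : ∀ {p} → Minimal p → weight p ≤ D
    minimal-weight≤ {p} p-min with reachable-within ⟦ p ⟧
    ... | q , q≤D , q≈p = ≤-trans (⊑⇒weight≤ (least p-min q q≈p)) q≤D

    axis₁-length : ∃ λ l → ¬ Minimal (l , 0) × ∀ {i} → i < l → Minimal (i , 0)
    axis₁-length with least-witness (λ i → ¬? (minimal? (i , 0))) {suc D}
                        (λ m → 1+n≰n (subst (_≤ D) (+-identityʳ (suc D)) (minimal-weight≤ m)))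
    ... | l , ¬minimal-l , below = l , ¬minimal-l , λ i<l → decidable-stable (minimal? _) (below i<l)

    axis₂-length : ∃ λ h → ¬ Minimal (0 , h) × ∀ {j} → j < h → Minimal (0 , j)
    axis₂-length with least-witness (λ j → ¬? (minimal? (0 , j))) {suc D}
                        (λ m → 1+n≰n (minimal-weight≤ m))
    ... | h , ¬minimal-h , below = h , ¬minimal-h , λ j<h → decidable-stable (minimal? _) (below j<h)

    order-bound : 3 * N ≤ (D + 2) * (D + 2)
    order-bound with axis₁-length | axis₂-length
    ... | l , ¬minimal-l , below-l | h , ¬minimal-h , below-h
      with axis₁-return ¬minimal-l below-l | axis₂-return ¬minimal-h below-h
    ...   | y , y-min , rel₁ , y⊏ | w , w-min , rel₂ , w⊏
      with <⇒≡suc+ (≰⇒> λ l≤w → ¬minimal-l (minimal-mono l≤w z≤n w-min))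
         | <⇒≡suc+ (≰⇒> λ h≤y → ¬minimal-h (minimal-mono z≤n h≤y y-min))
    ...     | A′ , refl | B′ , refl =
      ≤-trans (*-monoʳ-≤ 3 order≤area)
        (≤-trans (lShape-area-bound (suc A′) w (suc B′) y) (*-mono-≤ size≤ size≤))
      where
      open LTile (suc A′) w (suc B′) y z<s z<s rel₁ rel₂ y⊏ w⊏
      order≤area : N ≤ suc A′ * (suc B′ + y) + w * suc B′
      order≤area = subst (N ≤_) (length-lShape (suc A′) w (suc B′) y)
        (order≤length G order ψ ψ-injective _ λ η → ∈-lShape (minimal⇒InL (ψ-minimal η)))
      size≤ : suc A′ + suc B′ + (w ⊔ y) ≤ D + 2
      size≤ = lShape-size-bound A′ w B′ y D
        (minimal-weight≤ (InL⇒minimal below-l below-h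
          (≤-refl , s≤s (m≤m+n B′ y) , λ (_ , B≤B′) → 1+n≰n B≤B′)))
        (minimal-weight≤ (InL⇒minimal below-l below-h
          (s≤s (m≤m+n A′ w) , ≤-refl , λ (A≤A′ , _) → 1+n≰n A≤A′)))

order-diameter-bound : (G : AbelianGroup 0ℓ 0ℓ) {a b : AbelianGroup.Carrier G} {N D : ℕ} →
  HasOrder G N → IsDiameter G a b D → 3 * N ≤ (D + 2) * (D + 2)
order-diameter-bound G {a} {b} order (diameter , _) = Representations.order-bound G a b order diameter

-- The groups ℤ_m ⊕ ℤ_n

module _ where
  open import Data.Integer using (+_; -[1+_]; -_)

  [+x]-[+y]≡+z⇒x≡z+y : ∀ {x y z} → + x ℤ.- + y ≡ + z → x ≡ z + y
  [+x]-[+y]≡+z⇒x≡z+y {x} {y} {z} eq = ℤₚ.+-injective (≡.trans (x≡x-y+y (+ x) (+ y)) (cong (ℤ._+ + y) eq))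
    where
    x≡x-y+y : ∀ x y → x ≡ (x ℤ.- y) ℤ.+ y
    x≡x-y+y = ℤ-Solver.solve-∀

  n≤[1+k]*n+m : ∀ n k m → n ≤ suc k * n + m
  n≤[1+k]*n+m n k m = ≤-trans (m≤m+n n (k * n)) (m≤m+n _ m)

  residue-unique : ∀ n {a b} → a < n → b < n → ModEq n (+ a) (+ b) → a ≡ b
  residue-unique n _ _ (+ zero , a-b≡0) = [+x]-[+y]≡+z⇒x≡z+y a-b≡0
  residue-unique n {a} {b} a<n _ (+ suc k , a-b≡kn) =
    ⊥-elim (<⇒≱ a<n (subst (n ≤_)
      (≡.sym ([+x]-[+y]≡+z⇒x≡z+y (≡.trans a-b≡kn (≡.sym (ℤₚ.pos-* (suc k) n))))) (n≤[1+k]*n+m n k b)))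
  residue-unique n {a} {b} _ b<n (-[1+ k ] , a-b≡kn) =
    ⊥-elim (<⇒≱ b<n (subst (n ≤_) (≡.sym ([+x]-[+y]≡+z⇒x≡z+y b-a≡kn)) (n≤[1+k]*n+m n k a)))
    where
    swap : ∀ x y → y ℤ.- x ≡ - (x ℤ.- y)
    swap = ℤ-Solver.solve-∀
    b-a≡kn : + b ℤ.- + a ≡ + (suc k * n)
    b-a≡kn = begin
      + b ℤ.- + a              ≡⟨ swap (+ a) (+ b) ⟩
      - (+ a ℤ.- + b)          ≡⟨ cong -_ a-b≡kn ⟩
      - (-[1+ k ] ℤ.* + n)     ≡⟨ ℤₚ.neg-distribˡ-* -[1+ k ] (+ n) ⟩
      + suc k ℤ.* + n          ≡⟨ ℤₚ.pos-* (suc k) n ⟨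
      + (suc k * n)            ∎
      where open ≡.≡-Reasoning

  %ℕ-ModEq : ∀ x n .{{_ : NonZero n}} → ModEq n (+ (x %ℕ n)) x
  %ℕ-ModEq x n = - (x /ℕ n) , (begin
    + (x %ℕ n) ℤ.- x                                   ≡⟨ cong (λ z → + (x %ℕ n) ℤ.- z) (a≡a%ℕn+[a/ℕn]*n x n) ⟩
    + (x %ℕ n) ℤ.- (+ (x %ℕ n) ℤ.+ (x /ℕ n) ℤ.* + n)   ≡⟨ cancel (+ (x %ℕ n)) (x /ℕ n) (+ n) ⟩
    - (x /ℕ n) ℤ.* + n                                 ∎)
    where
    open ≡.≡-Reasoning
    cancel : ∀ r q n → r ℤ.- (r ℤ.+ q ℤ.* n) ≡ - q ℤ.* n
    cancel = ℤ-Solver.solve-∀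

  ZmZn-order : ∀ m n .{{_ : NonZero m}} .{{_ : NonZero n}} → HasOrder (ZmZn m n) (n * m)
  ZmZn-order m n = e , e-injective , e-surjective
    where
    open AbelianGroup (ZmZn m n) using (_≈_) renaming (trans to ≈-trans; reflexive to ≈-reflexive)
    e : Fin (n * m) → ℤ × ℤ
    e k = + toℕ (proj₂ (remQuot {n} m k)) , + toℕ (proj₁ (remQuot {n} m k))
    residues-injective : ∀ {k} {i j : Fin k} → ModEq k (+ toℕ i) (+ toℕ j) → i ≡ j
    residues-injective {k} i≡j = Fin.toℕ-injective (residue-unique k (Fin.toℕ<n _) (Fin.toℕ<n _) i≡j)
    e-injective : ∀ k k′ → e k ≈ e k′ → k ≡ k′
    e-injective k k′ (≡₁ , ≡₂) = begin
      k
        ≡⟨ Fin.combine-remQuot {n} m k ⟨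
      combine (proj₁ (remQuot {n} m k)) (proj₂ (remQuot {n} m k))
        ≡⟨ cong₂ combine (residues-injective ≡₂) (residues-injective ≡₁) ⟩
      combine (proj₁ (remQuot {n} m k′)) (proj₂ (remQuot {n} m k′))
        ≡⟨ Fin.combine-remQuot {n} m k′ ⟩
      k′ ∎
      where open ≡.≡-Reasoning
    e-surjective : ∀ x → ∃ λ k → e k ≈ x
    e-surjective (x₁ , x₂) =
      combine r₂ r₁ ,
      ≈-trans {e (combine r₂ r₁)} {+ (x₁ %ℕ m) , + (x₂ %ℕ n)} {x₁ , x₂}
        (≈-reflexive e-combine) (%ℕ-ModEq x₁ m , %ℕ-ModEq x₂ n)
      where
      r₁ : Fin m
      r₁ = fromℕ< (n%ℕd<d x₁ m)
      r₂ : Fin n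
      r₂ = fromℕ< (n%ℕd<d x₂ n)
      e-combine : e (combine r₂ r₁) ≡ (+ (x₁ %ℕ m) , + (x₂ %ℕ n))
      e-combine = ≡.trans (cong (λ (i , j) → + toℕ j , + toℕ i) (Fin.remQuot-combine r₂ r₁))
                          (cong₂ (λ a b → + a , + b) (Fin.toℕ-fromℕ< _) (Fin.toℕ-fromℕ< _))

  nmul-ZmZn : ∀ {m n} k (g : ℤ × ℤ) → nmul (ZmZn m n) k g ≡ (+ k ℤ.* proj₁ g , + k ℤ.* proj₂ g)
  nmul-ZmZn zero g = refl
  nmul-ZmZn {m} {n} (suc k) (g₁ , g₂) rewrite nmul-ZmZn {m} {n} k (g₁ , g₂) =
    cong₂ _,_ (≡.sym (ℤₚ.suc-* (+ k) g₁)) (≡.sym (ℤₚ.suc-* (+ k) g₂))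

  zmul-ZmZn : ∀ {m n} z (g : ℤ × ℤ) → zmul (ZmZn m n) z g ≡ (z ℤ.* proj₁ g , z ℤ.* proj₂ g)
  zmul-ZmZn {m} {n} (+ k) g = nmul-ZmZn {m} {n} k g
  zmul-ZmZn {m} {n} -[1+ k ] (g₁ , g₂) =
    ≡.trans (cong (λ (x₁ , x₂) → - x₁ , - x₂) (nmul-ZmZn {m} {n} (suc k) (g₁ , g₂)))
            (cong₂ _,_ (ℤₚ.neg-distribˡ-* (+ suc k) g₁) (ℤₚ.neg-distribˡ-* (+ suc k) g₂))

  1≢0-ModEq : ∀ {n} → 1 < n → ¬ ModEq n (+ 1) (+ 0)
  1≢0-ModEq 1<n 1≡0 = 1+n≢0 (residue-unique _ 1<n (<-trans z<s 1<n) 1≡0)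

  ZmZn-nonCyclic : ∀ {t} k → 1 < t → ¬ IsCyclic (ZmZn t (k * t))
  ZmZn-nonCyclic {t} k 1<t ((g₁ , g₂) , generator) with generator (+ 1 , + 0) | generator (+ 0 , + 1)
  ... | z , (c₀ , e₀) , (c₁ , e₁) | z′ , _ , (c₂ , e₂) =
    1≢0-ModEq 1<t (c₀ ℤ.+ g₁ ℤ.* + k ℤ.* (z ℤ.* c₂ ℤ.- z′ ℤ.* c₁) , (begin
      ℤ.1ℤ ℤ.- ℤ.0ℤ
        ≡⟨ split z z′ g₁ g₂ ⟩
      (ℤ.1ℤ ℤ.- z ℤ.* g₁) ℤ.+ g₁ ℤ.* (z ℤ.* (ℤ.1ℤ ℤ.- z′ ℤ.* g₂) ℤ.- z′ ℤ.* (ℤ.0ℤ ℤ.- z ℤ.* g₂))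
        ≡⟨ cong₂ (λ a b → a ℤ.+ g₁ ℤ.* b) (coordinate ℤ.1ℤ proj₁ z e₀)
                 (cong₂ (λ a b → z ℤ.* a ℤ.- z′ ℤ.* b) (coordinate ℤ.1ℤ proj₂ z′ e₂) (coordinate ℤ.0ℤ proj₂ z e₁)) ⟩
      c₀ ℤ.* + t ℤ.+ g₁ ℤ.* (z ℤ.* (c₂ ℤ.* + (k * t)) ℤ.- z′ ℤ.* (c₁ ℤ.* + (k * t)))
        ≡⟨ cong (λ kt → c₀ ℤ.* + t ℤ.+ g₁ ℤ.* (z ℤ.* (c₂ ℤ.* kt) ℤ.- z′ ℤ.* (c₁ ℤ.* kt))) (ℤₚ.pos-* k t) ⟩
      c₀ ℤ.* + t ℤ.+ g₁ ℤ.* (z ℤ.* (c₂ ℤ.* (+ k ℤ.* + t)) ℤ.- z′ ℤ.* (c₁ ℤ.* (+ k ℤ.* + t)))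
        ≡⟨ factor c₀ c₁ c₂ z z′ g₁ (+ k) (+ t) ⟩
      (c₀ ℤ.+ g₁ ℤ.* + k ℤ.* (z ℤ.* c₂ ℤ.- z′ ℤ.* c₁)) ℤ.* + t ∎))
    where
    open ≡.≡-Reasoning
    coordinate : ∀ x {c} (π : ℤ × ℤ → ℤ) z → x ℤ.- π (zmul (ZmZn t (k * t)) z (g₁ , g₂)) ≡ c →
      x ℤ.- π (z ℤ.* g₁ , z ℤ.* g₂) ≡ c
    coordinate x π z = ≡.trans (cong (λ g → x ℤ.- π g) (≡.sym (zmul-ZmZn {t} {k * t} z (g₁ , g₂))))
    split : ∀ z z′ g₁ g₂ → ℤ.1ℤ ℤ.- ℤ.0ℤ ≡
      (ℤ.1ℤ ℤ.- z ℤ.* g₁) ℤ.+ g₁ ℤ.* (z ℤ.* (ℤ.1ℤ ℤ.- z′ ℤ.* g₂) ℤ.- z′ ℤ.* (ℤ.0ℤ ℤ.- z ℤ.* g₂))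
    split = ℤ-Solver.solve-∀
    factor : ∀ c₀ c₁ c₂ z z′ g₁ k t →
      c₀ ℤ.* t ℤ.+ g₁ ℤ.* (z ℤ.* (c₂ ℤ.* (k ℤ.* t)) ℤ.- z′ ℤ.* (c₁ ℤ.* (k ℤ.* t))) ≡
      (c₀ ℤ.+ g₁ ℤ.* k ℤ.* (z ℤ.* c₂ ℤ.- z′ ℤ.* c₁)) ℤ.* t
    factor = ℤ-Solver.solve-∀

-- The L-shapes H_t and lb(3t²)

ceilSqrtFrom≡ : ∀ fuel r n k → r ≤ k → k ≤ r + fuel → (∀ {m} → r ≤ m → m < k → m * m < n) →
  n ≤ k * k → ceilSqrtFrom fuel r n ≡ k
ceilSqrtFrom≡ zero r n k r≤k k≤r _ _ = ≤-antisym r≤k (subst (k ≤_) (+-identityʳ r) k≤r)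
ceilSqrtFrom≡ (suc fuel) r n k r≤k k≤r below n≤k² with n ≤? r * r
... | yes n≤r² = ≤-antisym r≤k (≮⇒≥ λ r<k → <⇒≱ (below ≤-refl r<k) n≤r²)
... | no n≰r² = ceilSqrtFrom≡ fuel (suc r) n k
  (≤∧≢⇒< r≤k λ { refl → n≰r² n≤k² }) (subst (k ≤_) (+-suc r fuel) k≤r) (below ∘ <⇒≤) n≤k²

ceilSqrt-square : ∀ k → ceilSqrt (k * k) ≡ k
ceilSqrt-square zero = refl
ceilSqrt-square k@(suc _) =
  ceilSqrtFrom≡ (k * k) 0 (k * k) k z≤n (m≤m*n k k) (λ _ m<k → *-mono-< m<k m<k) ≤-refl

lb-3t² : ∀ t → lb (3 * (t * t)) ≡ 3 * t ∸ 2
lb-3t² t = cong (_∸ 2) (≡.trans (cong ceilSqrt (nine t)) (ceilSqrt-square (3 * t)))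
  where
  nine : ∀ t → 3 * (3 * (t * t)) ≡ 3 * t * (3 * t)
  nine = solve-∀

Ht-shape : ∀ t → Ht t ≡ L (2 * t) (2 * t) t t
Ht-shape t = cong₂ (λ l w → L l l w w) (*-comm t 2) (*-identityʳ t)

Ht-area : ∀ t → areaL (Ht t) ≡ 3 * (t * t)
Ht-area t = ≡.trans (cong (_∸ t * 1 * (t * 1)) (square t)) (m+n∸n≡m (3 * (t * t)) (t * 1 * (t * 1)))
  where
  square : ∀ t → t * 2 * (t * 2) ≡ 3 * (t * t) + t * 1 * (t * 1)
  square = solve-∀

Ht-diameter : ∀ t → diamL (Ht t) ≡ 3 * t ∸ 2
Ht-diameter t = cong (_∸ 2) (≡.trans (cong (t * 2 + t * 2 ∸_) (⊓-idem (t * 1)))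
  (≡.trans (cong (_∸ t * 1) (four t)) (m+n∸n≡m (3 * t) (t * 1))))
  where
  four : ∀ t → t * 2 + t * 2 ≡ 3 * t + t * 1
  four = solve-∀

Ht-tight : ∀ t → TightL (Ht t)
Ht-tight t = ≡.trans (Ht-diameter t) (≡.sym (≡.trans (cong lb (Ht-area t)) (lb-3t² t)))

-- t = 2 + u, so that 1 < t and the NonZero instances for t and 3t hold definitionally.
module Γ (u : ℕ) where
  open import Data.Integer using (+_; -_)

  t : ℕ
  t = 2 + u

  open AbelianGroup (Gt t) using (_≈_; setoid) renaming (reflexive to ≈-reflexive)
  open import Relation.Binary.Reasoning.Setoid setoid

  order : HasOrder (Gt t) (3 * (t * t))
  order = subst (HasOrder (Gt t)) (*-assoc 3 t t) (ZmZn-order t (3 * t))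

  nonCyclic : ¬ IsCyclic (Gt t)
  nonCyclic = ZmZn-nonCyclic 3 (s≤s (s≤s z≤n))

  generates : Is2Gen (Gt t) at bt
  generates =
    (λ at≈0 → 1≢0-ModEq {t} (s≤s (s≤s z≤n)) (proj₁ at≈0)) ,
    (λ bt≈0 → 1≢0-ModEq {3 * t} (s≤s (s≤s z≤n)) (proj₂ bt≈0)) ,
    (λ at≈bt → 1≢0-ModEq {t} (s≤s (s≤s z≤n)) (proj₁ at≈bt)) ,
    λ (x₁ , x₂) → x₁ , x₁ ℤ.+ x₂ , ≈-reflexive (≡.sym (≡.trans
      (cong₂ (λ p q → proj₁ p ℤ.+ proj₁ q , proj₂ p ℤ.+ proj₂ q)
             (zmul-ZmZn {t} {3 * t} x₁ at) (zmul-ZmZn {t} {3 * t} (x₁ ℤ.+ x₂) bt))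
      (cong₂ _,_ (first x₁ x₂) (second x₁ x₂))))
    where
    first : ∀ x y → x ℤ.* ℤ.1ℤ ℤ.+ (x ℤ.+ y) ℤ.* ℤ.0ℤ ≡ x
    first = ℤ-Solver.solve-∀
    second : ∀ x y → x ℤ.* (- ℤ.1ℤ) ℤ.+ (x ℤ.+ y) ℤ.* ℤ.1ℤ ≡ y
    second = ℤ-Solver.solve-∀

  open Representations (Gt t) at bt

  ⟦⟧-coordinates : ∀ i j → ⟦ i , j ⟧ ≡ (+ i , + j ℤ.- + i)
  ⟦⟧-coordinates i j = ≡.trans
    (cong₂ (λ p q → proj₁ p ℤ.+ proj₁ q , proj₂ p ℤ.+ proj₂ q)
           (nmul-ZmZn {t} {3 * t} i at) (nmul-ZmZn {t} {3 * t} j bt))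
    (cong₂ _,_ (first (+ i) (+ j)) (second (+ i) (+ j)))
    where
    first : ∀ x y → x ℤ.* ℤ.1ℤ ℤ.+ y ℤ.* ℤ.0ℤ ≡ x
    first = ℤ-Solver.solve-∀
    second : ∀ x y → x ℤ.* (- ℤ.1ℤ) ℤ.+ y ℤ.* ℤ.1ℤ ≡ y ℤ.- x
    second = ℤ-Solver.solve-∀

  ⟦⟧-≈ : ∀ i j i′ j′ → ModEq t (+ i) (+ i′) → ModEq (3 * t) (+ j ℤ.- + i) (+ j′ ℤ.- + i′) →
    ⟦ i , j ⟧ ≈ ⟦ i′ , j′ ⟧
  ⟦⟧-≈ i j i′ j′ i≡i′ j-i≡j′-i′ = begin
    ⟦ i , j ⟧                ≡⟨ ⟦⟧-coordinates i j ⟩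
    (+ i , + j ℤ.- + i)      ≈⟨ i≡i′ , j-i≡j′-i′ ⟩
    (+ i′ , + j′ ℤ.- + i′)   ≡⟨ ⟦⟧-coordinates i′ j′ ⟨
    ⟦ i′ , j′ ⟧              ∎

  rel₁ : ⟦ t + t , 0 ⟧ ≈ ⟦ 0 , t ⟧
  rel₁ = ⟦⟧-≈ (t + t) 0 0 t (+ 2 , first (+ t)) (- ℤ.1ℤ , second (+ t))
    where
    first : ∀ x → (x ℤ.+ x) ℤ.- ℤ.0ℤ ≡ (ℤ.1ℤ ℤ.+ ℤ.1ℤ) ℤ.* x
    first = ℤ-Solver.solve-∀
    second : ∀ x → (ℤ.0ℤ ℤ.- (x ℤ.+ x)) ℤ.- (x ℤ.- ℤ.0ℤ) ≡ (- ℤ.1ℤ) ℤ.* (x ℤ.+ (x ℤ.+ (x ℤ.+ ℤ.0ℤ)))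
    second = ℤ-Solver.solve-∀

  rel₂ : ⟦ 0 , t + t ⟧ ≈ ⟦ t , 0 ⟧
  rel₂ = ⟦⟧-≈ 0 (t + t) t 0 (- ℤ.1ℤ , first (+ t)) (ℤ.1ℤ , second (+ t))
    where
    first : ∀ x → ℤ.0ℤ ℤ.- x ≡ (- ℤ.1ℤ) ℤ.* x
    first = ℤ-Solver.solve-∀
    second : ∀ x → ((x ℤ.+ x) ℤ.- ℤ.0ℤ) ℤ.- (ℤ.0ℤ ℤ.- x) ≡ ℤ.1ℤ ℤ.* (x ℤ.+ (x ℤ.+ (x ℤ.+ ℤ.0ℤ)))
    second = ℤ-Solver.solve-∀

  reachable : ∀ η → ∃ λ p → ⟦ p ⟧ ≈ η
  reachable (x₁ , x₂) = (r₁ , r₂ + r₁) , (begin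
    ⟦ r₁ , r₂ + r₁ ⟧                ≡⟨ ⟦⟧-coordinates r₁ (r₂ + r₁) ⟩
    (+ r₁ , + (r₂ + r₁) ℤ.- + r₁)   ≡⟨ cong (+ r₁ ,_) (cancel (+ r₂) (+ r₁)) ⟩
    (+ r₁ , + r₂)                   ≈⟨ %ℕ-ModEq x₁ t , %ℕ-ModEq x₂ (3 * t) ⟩
    (x₁ , x₂)                       ∎)
    where
    r₁ = x₁ %ℕ t
    r₂ = x₂ %ℕ (3 * t)
    cancel : ∀ x y → (x ℤ.+ y) ℤ.- y ≡ x
    cancel = ℤ-Solver.solve-∀

  open Canonical (HasOrder⇒decidable (Gt t) order) reachable
  open LTile t t t t z<s z<s rel₁ rel₂
    (weight<⇒⊏ {0 , t} {t + t , 0} (subst (t <_) (≡.sym (+-identityʳ (t + t))) (m<m+n t z<s)))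
    (weight<⇒⊏ {t , 0} {0 , t + t} (subst (_< t + t) (≡.sym (+-identityʳ t)) (m<m+n t z<s)))

  -- ψ maps the 3t² elements injectively into the 3t² points of the L-shape, so it misses none.
  InL⇒minimal-by-counting : ∀ {p} → InL t t t t p → Minimal p
  InL⇒minimal-by-counting {p} p∈L = decidable-stable (minimal? p) λ ¬minimal-p →
    <-irrefl (≡.sym (≡.trans (length-lShape t t t t) (three t)))
      (order<length (Gt t) order ψ ψ-injective (lShape t t t t)
        (λ η → ∈-lShape (minimal⇒InL (ψ-minimal η))) (∈-lShape p∈L)
        (λ η ψη≡p → ¬minimal-p (subst Minimal ψη≡p (ψ-minimal η))))
    where
    three : ∀ t → t * (t + t) + t * t ≡ 3 * (t * t)
    three = solve-∀

  Ht-corner : Ht t ≡ L (t + t) (t + t) t t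
  Ht-corner = ≡.trans (Ht-shape t) (cong (λ s → L (t + s) (t + s) t t) (+-identityʳ t))

  mdd : IsMDD (Gt t) at bt (λ p → p ∈L Ht t)
  mdd = isMDD (λ p → p ∈L Ht t)
    (λ {p} p∈Ht → InL⇒minimal-by-counting (∈L⇒InL (subst (p ∈L_) Ht-corner p∈Ht)))
    (λ {p} p-min → subst (p ∈L_) (≡.sym Ht-corner) (InL⇒∈L (minimal⇒InL p-min)))

  diameter : IsDiameter (Gt t) at bt (3 * t ∸ 2)
  diameter = isDiameter weight≤ {suc u + t , suc u}
    (InL⇒minimal-by-counting (+-monoˡ-< t {suc u} {t} ≤-refl , m≤m+n t t , λ (_ , t≤suc-u) → 1+n≰n t≤suc-u))
    (≡.trans (≡.sym (m+n∸n≡m _ 2)) (cong (_∸ 2) (far-corner u)))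
    where
    weight≤ : ∀ {p} → Minimal p → weight p ≤ 3 * t ∸ 2
    weight≤ {p} p-min =
      m+n≤o⇒m≤o∸n (weight p) (subst (weight p + 2 ≤_) (three t) (InL-weight (minimal⇒InL p-min)))
      where
      three : ∀ t → t + t + (t ⊔ t) ≡ 3 * t
      three t = ≡.trans (cong (λ m → t + t + m) (⊔-idem t)) (triple t)
        where
        triple : ∀ t → t + t + t ≡ 3 * t
        triple = solve-∀
    far-corner : ∀ u → suc u + (2 + u) + suc u + 2 ≡ 3 * (2 + u)
    far-corner = solve-∀

  D₂ : IsD2 (3 * (t * t)) (3 * t ∸ 2)
  D₂ = (Gt t , at , bt , (order , nonCyclic , generates) , diameter) ,
    λ G a b (order′ , _ , _) d diameter′ →
      subst (3 * t ∸ 2 ≤_) (m+n∸n≡m d 2) (∸-monoˡ-≤ 2 (m*m≤n*n⇒m≤n {3 * t} {d + 2}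
        (subst (_≤ (d + 2) * (d + 2)) (nine t) (order-diameter-bound G order′ diameter′))))
    where
    nine : ∀ t → 3 * (3 * (t * t)) ≡ 3 * t * (3 * t)
    nine = solve-∀

theorem4 : (t : ℕ) → 2 ≤ t →
    ((Ht t ≡ L (2 * t) (2 * t) t t) × (areaL (Ht t) ≡ 3 * (t * t)) × TightL (Ht t) ×
      (Σ[ G ∈ AbelianGroup 0ℓ 0ℓ ] Σ[ a ∈ AbelianGroup.Carrier G ] Σ[ b ∈ AbelianGroup.Carrier G ]
        (Σ[ N ∈ ℕ ] HasOrder G N × Is2Gen G a b × IsMDD G a b (λ p → p ∈L Ht t)))) ×
    IsMDD (Gt t) at bt (λ p → p ∈L Ht t) ×
    (IsDiameter (Gt t) at bt (3 * t ∸ 2) × IsD2 (3 * (t * t)) (3 * t ∸ 2) × (lb (3 * (t * t)) ≡ 3 * t ∸ 2))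
theorem4 (suc (suc u)) (s≤s (s≤s z≤n)) =
  (Ht-shape t , Ht-area t , Ht-tight t , (Gt t , at , bt , 3 * (t * t) , order , generates , mdd)) ,
  mdd , diameter , D₂ , lb-3t² t
  where open Γ u
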